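{- For all positive integers $m,n$ and all prime numbers $p$: (i) $g(m)\mid g(n)$ whenever $m\mid n$; (ii) $n\mid g(m)$ if and only if $\ell(n)\mid m$; (iii) $n\in\mathcal{A}$ if and only if $n=g(\ell(n))$; (iv) if $\ell(p)\mid \ell(n)$ and $n\in\mathcal{A}$, then $p\mid n$; (v) $\ell(p)=p\,z(p)$ whenever $p\ne 5$, and $\ell(5)=5$; (vi) if $p\neq 3$ and $\ell(q)\nmid z(p)$ for all prime numbers $q$, then $p\in\mathcal{A}$.
   Context: Let $(F_n)_{n\ge1}$ be the Fibonacci sequence, $F_1=F_2=1$, $F_{n+2}=F_{n+1}+F_n$. For a positive integer $n$, $z(n)$ (the rank of appearance) is the smallest positive integer $k$ with $n\mid F_k$; $g(n):=\gcd(n,F_n)$; $\ell(n):=\operatorname{lcm}(n,z(n))$; and $\mathcal{A}:=\{g(n): n\ge1\}$. -}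

module Defs where

open import Data.Nat using (ℕ; zero; suc; _+_; _*_; _≤_; _<_)
open import Data.Nat.Divisibility using (_∣_; _∣?_)
open import Data.Nat.GCD using (gcd)
open import Data.Nat.LCM using (lcm)
open import Data.Product using (∃-syntax; _×_)
open import Relation.Nullary using (yes; no)
open import Relation.Binary.PropositionalEquality using (_≡_)

F : ℕ → ℕ
F zero = 0
F (suc zero) = 1
F (suc (suc n)) = F (suc n) + F n

-- search : first k in [start, start + fuel) with n ∣ F k, or 0 if none.
search : ℕ → ℕ → ℕ → ℕ
search n start zero = 0
search n start (suc fuel) with n ∣? F start
... | yes _ = start
... | no  _ = search n (suc start) fuel

-- Rank of appearance: smallest k ≥ 1 with n ∣ F k.
-- For n ≥ 1 such k exists and k ≤ n * n (pigeonhole on consecutive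
-- pairs mod n), so searching 1 .. n*n+1 returns exactly the least one.
z : ℕ → ℕ
z n = search n 1 (suc (n * n))

g : ℕ → ℕ
g n = gcd n (F n)

ℓ : ℕ → ℕ
ℓ n = lcm n (z n)

_∈𝒜 : ℕ → Set
a ∈𝒜 = ∃[ n ] (1 ≤ n × g n ≡ a)

module Submission where

-- Everything rests on the rank lemma  n ∣ F m ⇔ z n ∣ m  (for n ≥ 1). It needs
-- two Fibonacci facts: F a ∣ F (k·a), and "d ∣ F a, d ∣ F (a + b) ⇒ d ∣ F b"
-- (addition formula plus coprimality of consecutive terms); and that z n is
-- really the least zero of F modulo n, i.e. that a zero exists in 1 .. n²
-- (pigeonhole on pairs of consecutive residues). Parts (i)–(iv) then follow
-- formally from the rank lemma and the universal properties of gcd and lcm.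
--
-- Parts (v) and (vi) need the rank of a prime: every prime p ≠ 5 divides
-- F (p − 1)·F (p + 1). For odd p = 2h + 1 this comes from F p ≡ 5^h (mod p),
-- obtained by expanding (1 + √5)^p binomially (p ∣ p C k for 0 < k < p) and
-- Fermat's little theorem, together with Cassini's identity. Hence z p ∣ p ± 1,
-- so z p ≤ p + 1 and p ∤ z p, which gives (v). For (vi), write g (ℓ p) = t·p;
-- a prime factor of t is either p (impossible as p ∤ z p) or a prime q with
-- ℓ q ∣ z p (contradicting the hypothesis), because |p − q| ≥ 2 forces p ∤ ℓ q.

open import Data.Empty using (⊥)
open import Data.Fin using (Fin; toℕ; fromℕ<; combine)
open import Data.Fin.Properties using (pigeonhole; combine-injective; toℕ<n; toℕ-fromℕ<)
open import Data.List using (_∷_; [])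
import Data.List.Relation.Unary.All as All
open import Data.Nat
open import Data.Nat.Combinatorics
  using (_C_; nCn≡1; k>n⇒nCk≡0; nCk≡n!/k![n-k]!; k![n∸k]!∣n!; nCk+nC[k+1]≡[n+1]C[k+1])
open import Data.Nat.Coprimality using (Coprime; coprime-divisor; coprime⇒gcd≡1)
open import Data.Nat.Divisibility
open import Data.Nat.DivMod using (_%_; _/_; m%n<n; m≡m%n+[m/n]*n; m*[n/m]≡n)
open import Data.Nat.GCD using (gcd; gcd-greatest; gcd[m,n]∣m; gcd[m,n]∣n; gcd[m,n]≢0)
open import Data.Nat.LCM using (lcm; lcm-least; m∣lcm[m,n]; n∣lcm[m,n]; gcd*lcm)
open import Data.Nat.ListAction using (product)
open import Data.Nat.Primality
  using (Prime; euclidsLemma; prime⇒nonTrivial; prime⇒irreducible; prime⇒nonZero; prime?; ¬prime[0]; prime[2])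
open import Data.Nat.Primality.Factorisation using (factorise)
open import Data.Nat.Properties
open import Data.Nat.Tactic.RingSolver using (solve; solve-∀)
open import Data.Product using (_×_; _,_; proj₁; proj₂; ∃-syntax)
open import Data.Sum using (_⊎_; inj₁; inj₂; [_,_]′)
import Data.Sum as Sum
open import Function.Base using (_∘_; id)
open import Function.Bundles using (_⇔_; mk⇔; module Equivalence)
open import Level using (0ℓ)
open import Relation.Binary.Bundles using (Setoid)
open import Relation.Binary.Structures using (IsEquivalence)
open import Relation.Binary.PropositionalEquality
  using (_≡_; _≢_; refl; sym; trans; cong; cong₂; subst; module ≡-Reasoning)
import Relation.Binary.Reasoning.Setoid as SetoidReasoning
open import Relation.Nullary using (¬_; Dec; yes; no; contradiction)
open import Relation.Nullary.Decidable using (from-yes)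

open import Defs

-- Congruences of natural numbers

-- x ≡ y mod n, witnessed without subtraction: x + k₁·n = y + k₂·n.
infix 4 _≡_mod_
record _≡_mod_ (x y n : ℕ) : Set where
  constructor congruent
  field
    k₁ k₂   : ℕ
    balance : x + k₁ * n ≡ y + k₂ * n

module _ {n : ℕ} where

  mod-reflexive : ∀ {x y} → x ≡ y → x ≡ y mod n
  mod-reflexive refl = congruent 0 0 refl

  mod-refl : ∀ {x} → x ≡ x mod n
  mod-refl = mod-reflexive refl

  mod-sym : ∀ {x y} → x ≡ y mod n → y ≡ x mod n
  mod-sym (congruent a b e) = congruent b a (sym e)

  mod-trans : ∀ {x y w} → x ≡ y mod n → y ≡ w mod n → x ≡ w mod n
  mod-trans {x} {y} {w} (congruent a b e₁) (congruent c d e₂) =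
    congruent (a + c) (d + b) (begin
      x + (a + c) * n     ≡⟨ solve (x ∷ a ∷ c ∷ n ∷ []) ⟩
      (x + a * n) + c * n ≡⟨ cong (_+ c * n) e₁ ⟩
      (y + b * n) + c * n ≡⟨ solve (y ∷ b ∷ c ∷ n ∷ []) ⟩
      (y + c * n) + b * n ≡⟨ cong (_+ b * n) e₂ ⟩
      (w + d * n) + b * n ≡⟨ solve (w ∷ b ∷ d ∷ n ∷ []) ⟩
      w + (d + b) * n     ∎)
    where open ≡-Reasoning

  mod-+ : ∀ {x y u v} → x ≡ y mod n → u ≡ v mod n → x + u ≡ y + v mod n
  mod-+ {x} {y} {u} {v} (congruent a b e₁) (congruent c d e₂) =
    congruent (a + c) (b + d) (begin
      x + u + (a + c) * n       ≡⟨ solve (x ∷ u ∷ a ∷ c ∷ n ∷ []) ⟩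
      (x + a * n) + (u + c * n) ≡⟨ cong₂ _+_ e₁ e₂ ⟩
      (y + b * n) + (v + d * n) ≡⟨ solve (y ∷ v ∷ b ∷ d ∷ n ∷ []) ⟩
      y + v + (b + d) * n       ∎)
    where open ≡-Reasoning

  mod-* : ∀ {x y u v} → x ≡ y mod n → u ≡ v mod n → x * u ≡ y * v mod n
  mod-* {x} {y} {u} {v} (congruent a b e₁) (congruent c d e₂) =
    congruent (a * u + x * c + a * c * n) (b * v + y * d + b * d * n) (begin
      x * u + (a * u + x * c + a * c * n) * n ≡⟨ solve (x ∷ u ∷ a ∷ c ∷ n ∷ []) ⟩
      (x + a * n) * (u + c * n)               ≡⟨ cong₂ _*_ e₁ e₂ ⟩
      (y + b * n) * (v + d * n)               ≡⟨ solve (y ∷ v ∷ b ∷ d ∷ n ∷ []) ⟩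
      y * v + (b * v + y * d + b * d * n) * n ∎)
    where open ≡-Reasoning

  mod-cancelˡ-+ : ∀ a {x y} → a + x ≡ a + y mod n → x ≡ y mod n
  mod-cancelˡ-+ a {x} {y} (congruent c d e) = congruent c d (+-cancelˡ-≡ a _ _ (begin
    a + (x + c * n) ≡⟨ +-assoc a x _ ⟨
    a + x + c * n   ≡⟨ e ⟩
    a + y + d * n   ≡⟨ +-assoc a y _ ⟩
    a + (y + d * n) ∎))
    where open ≡-Reasoning

  mod0⇒∣ : ∀ {x} → x ≡ 0 mod n → n ∣ x
  mod0⇒∣ {x} (congruent a b e) =
    ∣m+n∣m⇒∣n (subst (n ∣_) (trans (sym e) (+-comm x (a * n))) (n∣m*n b)) (n∣m*n a)

  ∣⇒mod0 : ∀ {x} → n ∣ x → x ≡ 0 mod n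
  ∣⇒mod0 {x} (divides q e) = congruent 0 q (trans (+-identityʳ x) e)

  mod-+⇒∣ : ∀ {x t} → x ≡ x + t mod n → n ∣ t
  mod-+⇒∣ {x} {t} h =
    mod0⇒∣ (mod-sym (mod-cancelˡ-+ x (mod-trans (mod-reflexive (+-identityʳ x)) h)))

  ∣⇒mod-+ : ∀ {x t} → n ∣ t → x ≡ x + t mod n
  ∣⇒mod-+ {x} n∣t = mod-trans (mod-reflexive (sym (+-identityʳ x))) (mod-+ mod-refl (mod-sym (∣⇒mod0 n∣t)))

  mod-isEquivalence : IsEquivalence (λ x y → x ≡ y mod n)
  mod-isEquivalence = record { refl = mod-refl ; sym = mod-sym ; trans = mod-trans }

mod-% : ∀ {n} .{{_ : NonZero n}} a → a ≡ a % n mod n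
mod-% {n} a = congruent 0 (a / n) (begin
  a + 0 * n           ≡⟨ +-identityʳ a ⟩
  a                   ≡⟨ m≡m%n+[m/n]*n a n ⟩
  a % n + a / n * n   ∎)
  where open ≡-Reasoning

modSetoid : ℕ → Setoid 0ℓ 0ℓ
modSetoid n = record { isEquivalence = mod-isEquivalence {n} }

module ModReasoning (n : ℕ) = SetoidReasoning (modSetoid n)

mod-*-shift⇒∣ : ∀ {p} → Prime p → ∀ {k} → ¬ p ∣ k → ∀ {x t} → k * x ≡ k * (x + t) mod p → p ∣ t
mod-*-shift⇒∣ pp {k} p∤k {x} {t} h =
  [ (λ p∣k → contradiction p∣k p∤k) , id ]′
  (euclidsLemma k t pp (mod-+⇒∣ (mod-trans h (mod-reflexive (*-distribˡ-+ k x t)))))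

mod-cancelˡ-* : ∀ {p} → Prime p → ∀ k → ¬ p ∣ k → ∀ {x y} → k * x ≡ k * y mod p → x ≡ y mod p
mod-cancelˡ-* {p} pp k p∤k {x} {y} h =
  [ (λ x≤y → cancel x≤y h) , (λ y≤x → mod-sym (cancel y≤x (mod-sym h))) ]′ (≤-total x y)
  where
  cancel : ∀ {x y} → x ≤ y → k * x ≡ k * y mod p → x ≡ y mod p
  cancel {x} {y} x≤y h = subst (λ w → x ≡ w mod p) x+t≡y
    (∣⇒mod-+ (mod-*-shift⇒∣ pp p∤k (subst (λ w → k * x ≡ k * w mod p) (sym x+t≡y) h)))
    where
    x+t≡y : x + (y ∸ x) ≡ y
    x+t≡y = m+[n∸m]≡n x≤y

-- Fibonacci identities

F-+ : ∀ m n → F (m + suc n) ≡ F (suc m) * F (suc n) + F m * F n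
F-+ zero          n = sym (trans (+-identityʳ _) (*-identityˡ _))
F-+ (suc zero)    n = cong₂ _+_ (sym (*-identityˡ (F (suc n)))) (sym (*-identityˡ (F n)))
F-+ (suc (suc m)) n = begin
  F (suc m + suc n) + F (m + suc n)
    ≡⟨ cong₂ _+_ (F-+ (suc m) n) (F-+ m n) ⟩
  (F (suc (suc m)) * F (suc n) + F (suc m) * F n) + (F (suc m) * F (suc n) + F m * F n)
    ≡⟨ regroup (F (suc m)) (F m) (F (suc n)) (F n) ⟩
  F (suc (suc (suc m))) * F (suc n) + F (suc (suc m)) * F n ∎
  where
  open ≡-Reasoning
  regroup : ∀ a b c d → ((a + b) * c + a * d) + (a * c + b * d) ≡ ((a + b) + a) * c + (a + b) * d
  regroup = solve-∀

F∣F[k*a] : ∀ a k → F a ∣ F (k * a)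
F∣F[k*a] a       zero    = F a ∣0
F∣F[k*a] zero    (suc k) = subst (λ t → 0 ∣ F t) (sym (*-zeroʳ (suc k))) ∣-refl
F∣F[k*a] (suc a) (suc k) = subst (F (suc a) ∣_) (sym expand)
  (∣m∣n⇒∣m+n (n∣m*n (F (suc (k * suc a)))) (∣-trans (F∣F[k*a] (suc a) k) (m∣m*n (F a))))
  where
  expand : F (suc k * suc a) ≡ F (suc (k * suc a)) * F (suc a) + F (k * suc a) * F a
  expand = trans (cong F (+-comm (suc a) (k * suc a))) (F-+ (k * suc a) a)

F-coprime : ∀ n → Coprime (F n) (F (suc n))
F-coprime zero    (_ , i∣1)        = ∣1⇒≡1 i∣1
F-coprime (suc n) (i∣F₁₊ₙ , i∣F₂₊ₙ) = F-coprime n (∣m+n∣m⇒∣n i∣F₂₊ₙ i∣F₁₊ₙ , i∣F₁₊ₙ)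

-- If d divides F a and F (a + b) then it divides F b (by the addition
-- formula and coprimality of F a with F (a + 1)).
F-∣-cancel : ∀ {d} a b → d ∣ F a → d ∣ F (a + b) → d ∣ F b
F-∣-cancel zero    b _      d∣F[b] = d∣F[b]
F-∣-cancel {d} (suc a) b d∣F[a] d∣F[a+b] = coprime-divisor d⊥F[a] (subst (d ∣_) (*-comm (F b) (F a)) d∣F[b]*F[a])
  where
  expand : F (suc a + b) ≡ F (suc b) * F (suc a) + F b * F a
  expand = trans (cong F (+-comm (suc a) b)) (F-+ b a)
  d∣F[b]*F[a] : d ∣ F b * F a
  d∣F[b]*F[a] = ∣m+n∣m⇒∣n (subst (d ∣_) expand d∣F[a+b]) (∣-trans d∣F[a] (n∣m*n (F (suc b))))
  d⊥F[a] : Coprime d (F a)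
  d⊥F[a] (i∣d , i∣F[a]) = F-coprime a (i∣F[a] , ∣-trans i∣d d∣F[a])

cassini-even : ∀ h → F (2 * h) * F (2 + 2 * h) + 1 ≡ F (1 + 2 * h) * F (1 + 2 * h)
cassini-even zero    = refl
cassini-even (suc h) = subst (λ i → F i * F (2 + i) + 1 ≡ F (1 + i) * F (1 + i)) (sym (*-suc 2 h))
  (odd⇒even (F (1 + 2 * h)) (F (2 + 2 * h)) (even⇒odd (F (2 * h)) (F (1 + 2 * h)) (cassini-even h)))
  where
  open ≡-Reasoning
  -- with x = F i and y = F (i + 1)
  even⇒odd : ∀ x y → x * (y + x) + 1 ≡ y * y → y * ((y + x) + y) ≡ (y + x) * (y + x) + 1
  even⇒odd x y e = begin
    y * ((y + x) + y)             ≡⟨ solve (x ∷ y ∷ []) ⟩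
    y * y + y * (y + x)           ≡⟨ cong (_+ y * (y + x)) e ⟨
    x * (y + x) + 1 + y * (y + x) ≡⟨ solve (x ∷ y ∷ []) ⟩
    (y + x) * (y + x) + 1         ∎
  odd⇒even : ∀ x y → x * (y + x) ≡ y * y + 1 → y * ((y + x) + y) + 1 ≡ (y + x) * (y + x)
  odd⇒even x y e = begin
    y * ((y + x) + y) + 1       ≡⟨ solve (x ∷ y ∷ []) ⟩
    (y * y + 1) + y * (y + x)   ≡⟨ cong (_+ y * (y + x)) e ⟨
    x * (y + x) + y * (y + x)   ≡⟨ solve (x ∷ y ∷ []) ⟩
    (y + x) * (y + x)           ∎

-- Every n ≥ 1 divides some F k with 1 ≤ k ≤ n²

-- If the pairs (F i, F (i + 1)) and (F (i + d), F (i + d + 1)) agree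
-- modulo n, then running the recurrence backwards the pairs at 0 and d
-- agree as well; in particular n ∣ F d.
F-pairs-back : ∀ {n} i d → F i ≡ F (i + d) mod n → F (suc i) ≡ F (suc i + d) mod n → F 0 ≡ F d mod n
F-pairs-back zero        d h₀ _  = h₀
F-pairs-back {n} (suc i) d h₁ h₂ = F-pairs-back i d h₀ h₁
  where
  h₀ : F i ≡ F (i + d) mod n
  h₀ = mod-cancelˡ-+ (F (suc i)) (mod-trans h₂ (mod-+ (mod-sym h₁) mod-refl))

residue : ∀ n .{{_ : NonZero n}} → ℕ → Fin n
residue n a = fromℕ< (m%n<n a n)

same-residue : ∀ {n} .{{_ : NonZero n}} a b → residue n a ≡ residue n b → a ≡ b mod n
same-residue {n} a b e = mod-trans (mod-% a) (mod-trans
  (mod-reflexive (trans (sym (toℕ-fromℕ< _)) (trans (cong toℕ e) (toℕ-fromℕ< _)))) (mod-sym (mod-% b)))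

residuePair : ∀ n .{{_ : NonZero n}} → Fin (suc (n * n)) → Fin (n * n)
residuePair n i = combine (residue n (F (toℕ i))) (residue n (F (suc (toℕ i))))

-- Two of the n² + 1 residue pairs at 0 ≤ i ≤ n² coincide (pigeonhole); by
-- F-pairs-back their distance d satisfies n ∣ F d.
F-zero-bounded : ∀ n .{{_ : NonZero n}} → ∃[ d ] 1 ≤ d × d ≤ n * n × n ∣ F d
F-zero-bounded n with pigeonhole (n<1+n (n * n)) (residuePair n)
... | i , j , i<j , same = d , m<n⇒0<n∸m i<j , d≤n² , mod0⇒∣ (mod-sym (F-pairs-back (toℕ i) d F≡ F₊₁≡))
  where
  d : ℕ
  d = toℕ j ∸ toℕ i
  i+d≡j : toℕ i + d ≡ toℕ j
  i+d≡j = m+[n∸m]≡n (<⇒≤ i<j)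
  d≤n² : d ≤ n * n
  d≤n² = ≤-trans (m∸n≤m (toℕ j) (toℕ i)) (s≤s⁻¹ (toℕ<n j))
  residues : residue n (F (toℕ i)) ≡ residue n (F (toℕ j)) × residue n (F (suc (toℕ i))) ≡ residue n (F (suc (toℕ j)))
  residues = combine-injective _ _ _ _ same
  F≡ : F (toℕ i) ≡ F (toℕ i + d) mod n
  F≡ = subst (λ t → F (toℕ i) ≡ F t mod n) (sym i+d≡j) (same-residue _ _ (proj₁ residues))
  F₊₁≡ : F (suc (toℕ i)) ≡ F (suc (toℕ i) + d) mod n
  F₊₁≡ = subst (λ t → F (suc (toℕ i)) ≡ F (suc t) mod n) (sym i+d≡j) (same-residue _ _ (proj₂ residues))

-- The rank of appearance

record LeastFrom (n start s : ℕ) : Set where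
  field
    start≤s : start ≤ s
    n∣F[s]  : n ∣ F s
    least   : ∀ j → start ≤ j → j < s → ¬ n ∣ F j

search-least : ∀ n start fuel k → start ≤ k → k < start + fuel → n ∣ F k →
               LeastFrom n start (search n start fuel)
search-least n start zero k start≤k k<start+0 _ =
  contradiction (subst (k <_) (+-identityʳ start) k<start+0) (≤⇒≯ start≤k)
search-least n start (suc fuel) k start≤k k<end n∣F[k] with n ∣? F start
... | yes n∣F[start] = record
  { start≤s = ≤-refl ; n∣F[s]  = n∣F[start] ; least = λ j start≤j j<start → contradiction j<start (≤⇒≯ start≤j) }
... | no  n∤F[start] = record
  { start≤s = ≤-trans (n≤1+n start) (LeastFrom.start≤s rest)
  ; n∣F[s]  = LeastFrom.n∣F[s] rest
  ; least   = least }
  where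
  start<k : start < k
  start<k = ≤∧≢⇒< start≤k (λ { refl → n∤F[start] n∣F[k] })
  rest : LeastFrom n (suc start) (search n (suc start) fuel)
  rest = search-least n (suc start) fuel k start<k (subst (k <_) (+-suc start fuel) k<end) n∣F[k]
  least : ∀ j → start ≤ j → j < search n (suc start) fuel → ¬ n ∣ F j
  least j start≤j j<s with m≤n⇒m<n∨m≡n start≤j
  ... | inj₁ start<j = LeastFrom.least rest j start<j j<s
  ... | inj₂ refl    = n∤F[start]

-- For n ≥ 1, z n is the least positive index with n ∣ F (z n): the search
-- window 1 .. n² + 1 contains the witness of F-zero-bounded.
rank-least : ∀ n .{{_ : NonZero n}} → LeastFrom n 1 (z n)
rank-least n =
  let d , 1≤d , d≤n² , n∣F[d] = F-zero-bounded n in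
  search-least n 1 (suc (n * n)) d 1≤d (s≤s (m≤n⇒m≤1+n d≤n²)) n∣F[d]

rank-pos : ∀ n .{{_ : NonZero n}} → 1 ≤ z n
rank-pos n = LeastFrom.start≤s (rank-least n)

rank∣⇒∣F : ∀ n .{{_ : NonZero n}} m → z n ∣ m → n ∣ F m
rank∣⇒∣F n m (divides q m≡q*z) =
  subst (λ t → n ∣ F t) (sym m≡q*z) (∣-trans (LeastFrom.n∣F[s] (rank-least n)) (F∣F[k*a] (z n) q))

∣F⇒rank∣ : ∀ n .{{_ : NonZero n}} m → n ∣ F m → z n ∣ m
∣F⇒rank∣ n m n∣F[m] = m%n≡0⇒n∣m m (z n) (remainder-zero (m % z n) (m%n<n m (z n)) n∣F[r])
  where
  instance
    z≢0 : NonZero (z n)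
    z≢0 = >-nonZero (rank-pos n)
  -- m = q·z n + r with n ∣ F (q·z n), so n ∣ F r by F-∣-cancel
  n∣F[r] : n ∣ F (m % z n)
  n∣F[r] = F-∣-cancel (m / z n * z n) (m % z n) (rank∣⇒∣F n _ (n∣m*n (m / z n)))
    (subst (λ t → n ∣ F t) (trans (m≡m%n+[m/n]*n m (z n)) (+-comm (m % z n) _)) n∣F[m])
  remainder-zero : ∀ r → r < z n → n ∣ F r → r ≡ 0
  remainder-zero zero    _   _       = refl
  remainder-zero (suc r) r<z n∣F[r] = contradiction n∣F[r] (LeastFrom.least (rank-least n) (suc r) (s≤s z≤n) r<z)

-- Parts (i)–(iv): g, ℓ and 𝒜

-- (i) g is monotone for divisibility, since F m ∣ F n when m ∣ n.
g-mono-∣ : ∀ m n → m ∣ n → g m ∣ g n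
g-mono-∣ m n (divides q refl) =
  gcd-greatest (∣-trans (gcd[m,n]∣m m (F m)) (n∣m*n q)) (∣-trans (gcd[m,n]∣n m (F m)) (F∣F[k*a] m q))

-- (ii) n ∣ g m ⇔ ℓ n ∣ m: both say n ∣ m and z n ∣ m.
∣g⇔ℓ∣ : ∀ m n .{{_ : NonZero n}} → (n ∣ g m) ⇔ (ℓ n ∣ m)
∣g⇔ℓ∣ m n = mk⇔
  (λ n∣g → lcm-least (∣-trans n∣g (gcd[m,n]∣m m (F m))) (∣F⇒rank∣ n m (∣-trans n∣g (gcd[m,n]∣n m (F m)))))
  (λ ℓ∣m → gcd-greatest (∣-trans (m∣lcm[m,n] n (z n)) ℓ∣m) (rank∣⇒∣F n m (∣-trans (n∣lcm[m,n] n (z n)) ℓ∣m)))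

-- ℓ n ≠ 0, since gcd(n, z n)·ℓ n = n·z n ≠ 0.
ℓ-pos : ∀ n .{{_ : NonZero n}} → 1 ≤ ℓ n
ℓ-pos n = n≢0⇒n>0 ℓ≢0
  where
  instance
    z≢0 : NonZero (z n)
    z≢0 = >-nonZero (rank-pos n)
  ℓ≢0 : ℓ n ≢ 0
  ℓ≢0 ℓ≡0 = ≢-nonZero⁻¹ (n * z n) {{m*n≢0 n (z n)}}
    (trans (sym (gcd*lcm n (z n))) (trans (cong (gcd n (z n) *_) ℓ≡0) (*-zeroʳ (gcd n (z n)))))

-- (iii) n ∈ 𝒜 ⇔ n = g (ℓ n): ℓ n is the least index m with n ∣ g m.
∈𝒜⇔g[ℓ]≡ : ∀ n .{{_ : NonZero n}} → (n ∈𝒜) ⇔ (n ≡ g (ℓ n))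
∈𝒜⇔g[ℓ]≡ n = mk⇔ to (λ n≡g[ℓn] → ℓ n , ℓ-pos n , sym n≡g[ℓn])
  where
  to : n ∈𝒜 → n ≡ g (ℓ n)
  to (k , _ , g[k]≡n) = ∣-antisym (Equivalence.from (∣g⇔ℓ∣ (ℓ n) n) ∣-refl)
    (subst (g (ℓ n) ∣_) g[k]≡n (g-mono-∣ (ℓ n) k (Equivalence.to (∣g⇔ℓ∣ k n) (subst (n ∣_) (sym g[k]≡n) ∣-refl))))

-- (iv) for n ∈ 𝒜: ℓ p ∣ ℓ n implies p ∣ g (ℓ n) = n.
ℓ∣ℓ⇒∣ : ∀ n p .{{_ : NonZero n}} .{{_ : NonZero p}} → ℓ p ∣ ℓ n → n ∈𝒜 → p ∣ n
ℓ∣ℓ⇒∣ n p ℓp∣ℓn n∈𝒜 =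
  subst (p ∣_) (sym (Equivalence.to (∈𝒜⇔g[ℓ]≡ n) n∈𝒜)) (Equivalence.from (∣g⇔ℓ∣ (ℓ n) p) ℓp∣ℓn)

prime≥2 : ∀ {p} → Prime p → 2 ≤ p
prime≥2 {p} pp = nonTrivial⇒n>1 p {{prime⇒nonTrivial pp}}

prime∤! : ∀ {p} → Prime p → ∀ m → m < p → ¬ p ∣ m !
prime∤! pp zero    _   p∣1 = contradiction (∣1⇒≡1 p∣1) (λ p≡1 → <⇒≢ (prime≥2 pp) (sym p≡1))
prime∤! pp (suc m) m<p p∣m! with euclidsLemma (suc m) (m !) pp p∣m!
... | inj₁ p∣1+m = contradiction (∣⇒≤ p∣1+m) (<⇒≱ m<p)
... | inj₂ p∣m!  = prime∤! pp m (<-trans (n<1+n m) m<p) p∣m!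

C-factorials : ∀ {n k} → k ≤ n → (k ! * (n ∸ k) !) * (n C k) ≡ n !
C-factorials {n} {k} k≤n = trans (cong ((k ! * (n ∸ k) !) *_) (nCk≡n!/k![n-k]! k≤n))
  (m*[n/m]≡n {{k !* (n ∸ k) !≢0}} (k![n∸k]!∣n! k≤n))

-- p ∣ (p C k) for 0 < k < p: p divides p! but neither k! nor (p − k)!.
prime∣C : ∀ {p} → Prime p → ∀ {k} → 0 < k → k < p → p ∣ (p C k)
prime∣C {p} pp {k} 0<k k<p with euclidsLemma (k ! * (p ∸ k) !) (p C k) pp p∣product
  where
  p∣product : p ∣ (k ! * (p ∸ k) !) * (p C k)
  p∣product = subst (p ∣_) (sym (C-factorials (<⇒≤ k<p))) (p∣p! p (<⇒≤ (prime≥2 pp)))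
    where
    p∣p! : ∀ p → 1 ≤ p → p ∣ p !
    p∣p! (suc p) _ = m∣m*n (p !)
... | inj₂ p∣C = p∣C
... | inj₁ p∣k![p-k]! with euclidsLemma (k !) ((p ∸ k) !) pp p∣k![p-k]!
...   | inj₁ p∣k!     = contradiction p∣k! (prime∤! pp k k<p)
...   | inj₂ p∣[p-k]! = contradiction p∣[p-k]! (prime∤! pp (p ∸ k) (∸-monoʳ-< 0<k (<⇒≤ k<p)))

-- Binomial sums and Fermat's little theorem

-- binomialSum n w = Σ_{k ≤ n} (n C k)·w k, computed by Pascal's rule.
binomialSum : ℕ → (ℕ → ℕ) → ℕ
binomialSum zero    w = w 0
binomialSum (suc n) w = binomialSum n w + binomialSum n (w ∘ suc)

coeffSum : ℕ → ℕ → (ℕ → ℕ) → ℕ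
coeffSum n zero    w = 0
coeffSum n (suc m) w = coeffSum n m w + (n C m) * w m

coeffSum-pascal : ∀ n m w → coeffSum (suc n) (suc m) w ≡ coeffSum n (suc m) w + coeffSum n m (w ∘ suc)
coeffSum-pascal n zero    w = sym (+-identityʳ _)
coeffSum-pascal n (suc m) w = begin
  coeffSum (suc n) (suc m) w + (suc n C suc m) * w (suc m)
    ≡⟨ cong₂ _+_ (coeffSum-pascal n m w) (cong (_* w (suc m)) (sym (nCk+nC[k+1]≡[n+1]C[k+1] n m))) ⟩
  (A + B) + (n C m + n C suc m) * w (suc m)
    ≡⟨ regroup A B (n C m) (n C suc m) (w (suc m)) ⟩
  (A + (n C suc m) * w (suc m)) + (B + (n C m) * w (suc m)) ∎
  where
  open ≡-Reasoning
  A B : ℕ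
  A = coeffSum n (suc m) w
  B = coeffSum n m (w ∘ suc)
  regroup : ∀ a b c d x → (a + b) + (c + d) * x ≡ (a + d * x) + (b + c * x)
  regroup = solve-∀

binomialSum-expand : ∀ n w → binomialSum n w ≡ coeffSum n (suc n) w
binomialSum-expand zero    w = sym (+-identityʳ (w 0))
binomialSum-expand (suc n) w = begin
  binomialSum n w + binomialSum n (w ∘ suc)
    ≡⟨ cong₂ _+_ (binomialSum-expand n w) (binomialSum-expand n (w ∘ suc)) ⟩
  coeffSum n (suc n) w + coeffSum n (suc n) (w ∘ suc)
    ≡⟨ cong (_+ coeffSum n (suc n) (w ∘ suc)) top-term-vanishes ⟩
  coeffSum n (suc (suc n)) w + coeffSum n (suc n) (w ∘ suc)
    ≡⟨ coeffSum-pascal n (suc n) w ⟨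
  coeffSum (suc n) (suc (suc n)) w ∎
  where
  open ≡-Reasoning
  top-term-vanishes : coeffSum n (suc n) w ≡ coeffSum n (suc (suc n)) w
  top-term-vanishes = sym (trans
    (cong (λ c → coeffSum n (suc n) w + c * w (suc n)) (k>n⇒nCk≡0 (n<1+n n))) (+-identityʳ _))

binomialSum-frobenius : ∀ {p} → Prime p → ∀ w → binomialSum p w ≡ w 0 + w p mod p
binomialSum-frobenius {zero}  pp w = contradiction pp ¬prime[0]
binomialSum-frobenius {suc p} pp w = mod-trans (mod-reflexive (binomialSum-expand (suc p) w))
  (mod-+ (inner p ≤-refl) (mod-reflexive (trans (cong (_* w (suc p)) (nCn≡1 (suc p))) (*-identityˡ _))))
  where
  inner : ∀ m → m ≤ p → coeffSum (suc p) (suc m) w ≡ w 0 mod suc p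
  inner zero    _   = mod-reflexive (+-identityʳ (w 0))
  inner (suc m) m<p = mod-trans (mod-+ (inner m (<⇒≤ m<p)) (∣⇒mod0 (∣-trans (prime∣C pp (s≤s z≤n) (s≤s m<p)) (m∣m*n _))))
    (mod-reflexive (+-identityʳ (w 0)))

binomialSum-* : ∀ n c w → binomialSum n (λ k → c * w k) ≡ c * binomialSum n w
binomialSum-* zero    c w = refl
binomialSum-* (suc n) c w =
  trans (cong₂ _+_ (binomialSum-* n c w) (binomialSum-* n c (w ∘ suc))) (sym (*-distribˡ-+ c _ _))

binomialSum-^ : ∀ n a → binomialSum n (a ^_) ≡ (1 + a) ^ n
binomialSum-^ zero    a = refl
binomialSum-^ (suc n) a = begin
  binomialSum n (a ^_) + binomialSum n (λ k → a * a ^ k) ≡⟨ cong (binomialSum n (a ^_) +_) (binomialSum-* n a (a ^_)) ⟩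
  binomialSum n (a ^_) + a * binomialSum n (a ^_)       ≡⟨ cong (λ x → x + a * x) (binomialSum-^ n a) ⟩
  (1 + a) ^ n + a * (1 + a) ^ n                          ≡⟨⟩
  (1 + a) * (1 + a) ^ n                                  ∎
  where open ≡-Reasoning

-- Fermat's little theorem, by induction on a: (1 + a)^p ≡ 1 + a^p ≡ 1 + a.
fermat : ∀ {p} → Prime p → ∀ a → a ^ p ≡ a mod p
fermat {zero}  pp _       = contradiction pp ¬prime[0]
fermat {suc p} pp zero    = mod-refl
fermat {suc p} pp (suc a) = mod-trans (mod-reflexive (sym (binomialSum-^ (suc p) a)))
  (mod-trans (binomialSum-frobenius pp (a ^_)) (mod-+ mod-refl (fermat pp a)))

-- A binomial formula for F n

-- Lucas numbers, the companions of F in (1 + √5)^n = 2^(n−1)·(L n + F n·√5).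
L : ℕ → ℕ
L zero          = 2
L (suc zero)    = 1
L (suc (suc n)) = L (suc n) + L n

F+L : ∀ n → F n + L n ≡ 2 * F (suc n)
F+L zero          = refl
F+L (suc zero)    = refl
F+L (suc (suc n)) = begin
  (F (suc n) + F n) + (L (suc n) + L n) ≡⟨ regroup (F (suc n)) (F n) (L (suc n)) (L n) ⟩
  (F (suc n) + L (suc n)) + (F n + L n) ≡⟨ cong₂ _+_ (F+L (suc n)) (F+L n) ⟩
  2 * F (suc (suc n)) + 2 * F (suc n)   ≡⟨ *-distribˡ-+ 2 (F (suc (suc n))) (F (suc n)) ⟨
  2 * F (suc (suc (suc n)))             ∎
  where
  open ≡-Reasoning
  regroup : ∀ a b c d → (a + b) + (c + d) ≡ (a + c) + (b + d)
  regroup = solve-∀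

L+5F : ∀ n → L n + 5 * F n ≡ 2 * L (suc n)
L+5F zero          = refl
L+5F (suc zero)    = refl
L+5F (suc (suc n)) = begin
  (L (suc n) + L n) + 5 * (F (suc n) + F n) ≡⟨ regroup (L (suc n)) (L n) (F (suc n)) (F n) ⟩
  (L (suc n) + 5 * F (suc n)) + (L n + 5 * F n) ≡⟨ cong₂ _+_ (L+5F (suc n)) (L+5F n) ⟩
  2 * L (suc (suc n)) + 2 * L (suc n)       ≡⟨ *-distribˡ-+ 2 (L (suc (suc n))) (L (suc n)) ⟨
  2 * L (suc (suc (suc n)))                 ∎
  where
  open ≡-Reasoning
  regroup : ∀ a b c d → (a + b) + 5 * (c + d) ≡ (a + 5 * c) + (b + 5 * d)
  regroup = solve-∀

-- √5^k = even5 k + odd5 k·√5: even5 (2h) = odd5 (2h + 1) = 5^h, all other values are 0.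
odd5 even5 : ℕ → ℕ
odd5 zero     = 0
odd5 (suc k)  = even5 k
even5 zero    = 1
even5 (suc k) = 5 * odd5 k

even5[2h] : ∀ h → even5 (2 * h) ≡ 5 ^ h
even5[2h] zero    = refl
even5[2h] (suc h) = trans (cong even5 (*-suc 2 h)) (cong (5 *_) (even5[2h] h))

-- Expanding (1 + √5)^n binomially: 2·Σ (n C k)·odd5 k = 2^n·F n, and similarly for L.
binet : ∀ n → 2 * binomialSum n odd5 ≡ 2 ^ n * F n × 2 * binomialSum n even5 ≡ 2 ^ n * L n
binet zero    = refl , refl
binet (suc n) = odd-part , even-part
  where
  open ≡-Reasoning
  X Y : ℕ
  X = binomialSum n odd5
  Y = binomialSum n even5
  odd-part : 2 * (X + Y) ≡ 2 ^ suc n * F (suc n)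
  odd-part = begin
    2 * (X + Y)               ≡⟨ *-distribˡ-+ 2 X Y ⟩
    2 * X + 2 * Y             ≡⟨ cong₂ _+_ (proj₁ (binet n)) (proj₂ (binet n)) ⟩
    2 ^ n * F n + 2 ^ n * L n ≡⟨ *-distribˡ-+ (2 ^ n) (F n) (L n) ⟨
    2 ^ n * (F n + L n)       ≡⟨ cong (2 ^ n *_) (F+L n) ⟩
    2 ^ n * (2 * F (suc n))   ≡⟨ shift (2 ^ n) (F (suc n)) ⟩
    2 ^ suc n * F (suc n)     ∎
    where
    shift : ∀ a b → a * (2 * b) ≡ 2 * a * b
    shift = solve-∀
  even-part : 2 * (Y + binomialSum n (λ k → 5 * odd5 k)) ≡ 2 ^ suc n * L (suc n)
  even-part = begin
    2 * (Y + binomialSum n (λ k → 5 * odd5 k)) ≡⟨ cong (λ t → 2 * (Y + t)) (binomialSum-* n 5 odd5) ⟩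
    2 * (Y + 5 * X)                            ≡⟨ regroup X Y ⟩
    2 * Y + 5 * (2 * X)                        ≡⟨ cong₂ (λ u v → u + 5 * v) (proj₂ (binet n)) (proj₁ (binet n)) ⟩
    2 ^ n * L n + 5 * (2 ^ n * F n)            ≡⟨ factor (2 ^ n) (L n) (F n) ⟩
    2 ^ n * (L n + 5 * F n)                    ≡⟨ cong (2 ^ n *_) (L+5F n) ⟩
    2 ^ n * (2 * L (suc n))                    ≡⟨ shift (2 ^ n) (L (suc n)) ⟩
    2 ^ suc n * L (suc n)                      ∎
    where
    regroup : ∀ x y → 2 * (y + 5 * x) ≡ 2 * y + 5 * (2 * x)
    regroup = solve-∀
    factor : ∀ a l f → a * l + 5 * (a * f) ≡ a * (l + 5 * f)
    factor = solve-∀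
    shift : ∀ a b → a * (2 * b) ≡ 2 * a * b
    shift = solve-∀

-- Every prime p ≠ 5 divides F (p − 1)·F (p + 1)

even-or-odd : ∀ n → (∃[ h ] n ≡ 2 * h) ⊎ (∃[ h ] n ≡ suc (2 * h))
even-or-odd zero    = inj₁ (0 , refl)
even-or-odd (suc n) with even-or-odd n
... | inj₁ (h , refl) = inj₂ (h , refl)
... | inj₂ (h , refl) = inj₁ (suc h , sym (*-suc 2 h))

even-prime : ∀ {p} → Prime p → 2 ∣ p → p ≡ 2
even-prime pp 2∣p with prime⇒irreducible pp 2∣p
... | inj₁ ()
... | inj₂ 2≡p = sym 2≡p

prime-2-or-odd : ∀ {p} → Prime p → p ≡ 2 ⊎ ∃[ h ] p ≡ suc (2 * h)
prime-2-or-odd {p} pp with even-or-odd p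
... | inj₁ (h , p≡2h) = inj₁ (even-prime pp (divides h (trans p≡2h (*-comm 2 h))))
... | inj₂ odd        = inj₂ odd

odd-prime∤2 : ∀ {p h} → Prime p → p ≡ suc (2 * h) → ¬ p ∣ 2
odd-prime∤2 {p} {h} pp p≡2h+1 p∣2 with prime⇒irreducible prime[2] p∣2
... | inj₁ p≡1 = <⇒≢ (prime≥2 pp) (sym p≡1)
... | inj₂ p≡2 = even≢odd 1 h (trans (sym p≡2) p≡2h+1)

-- For an odd prime p = 2h + 1: F p ≡ 5^h, from 2^p·F p = 2·Σ (p C k)·odd5 k ≡ 2·odd5 p.
F[p]≡5^h : ∀ {p h} → Prime p → p ≡ suc (2 * h) → F p ≡ 5 ^ h mod p
F[p]≡5^h {p} {h} pp p≡2h+1 = mod-cancelˡ-* pp 2 (odd-prime∤2 {h = h} pp p≡2h+1) (begin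
  2 * F p                        ≈⟨ mod-* (mod-sym (fermat pp 2)) (mod-refl {x = F p}) ⟩
  2 ^ p * F p                    ≡⟨ proj₁ (binet p) ⟨
  2 * binomialSum p odd5         ≈⟨ mod-* (mod-refl {x = 2}) (binomialSum-frobenius pp odd5) ⟩
  2 * (odd5 0 + odd5 p)          ≡⟨ cong (λ i → 2 * odd5 i) p≡2h+1 ⟩
  2 * even5 (2 * h)              ≡⟨ cong (2 *_) (even5[2h] h) ⟩
  2 * 5 ^ h                      ∎)
  where open ModReasoning p

-- Hence F p² ≡ 5^(p − 1) ≡ 1 by Fermat, and by Cassini p ∣ F (p − 1)·F (p + 1).
odd-prime∣F[p-1]F[p+1] : ∀ {p h} → Prime p → p ≢ 5 → p ≡ suc (2 * h) → p ∣ F (p ∸ 1) * F (suc p)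
odd-prime∣F[p-1]F[p+1] {p} {h} pp p≢5 refl = mod0⇒∣ (mod-cancelˡ-+ 1 (begin
  1 + F (2 * h) * F (2 + 2 * h)  ≡⟨ trans (+-comm 1 _) (cassini-even h) ⟩
  F p * F p                      ≈⟨ mod-* (F[p]≡5^h {h = h} pp refl) (F[p]≡5^h {h = h} pp refl) ⟩
  5 ^ h * 5 ^ h                  ≈⟨ mod-cancelˡ-* pp 5 p∤5 5·25^h≡5 ⟩
  1                              ≡⟨ +-identityʳ 1 ⟨
  1 + 0                          ∎))
  where
  open ModReasoning p
  p∤5 : ¬ p ∣ 5
  p∤5 p∣5 with prime⇒irreducible (from-yes (prime? 5)) p∣5
  ... | inj₁ p≡1 = <⇒≢ (prime≥2 pp) (sym p≡1)
  ... | inj₂ p≡5 = p≢5 p≡5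
  -- 5·(5^h)² = 5^p ≡ 5 by Fermat, so (5^h)² ≡ 1 after cancelling 5
  5·25^h≡5 : 5 * (5 ^ h * 5 ^ h) ≡ 5 * 1 mod p
  5·25^h≡5 = mod-trans (mod-reflexive {x = 5 * (5 ^ h * 5 ^ h)} (cong (5 *_) (sym (^-distribˡ-+-* 5 h h))))
    (mod-trans (mod-reflexive (cong (λ e → 5 ^ suc (h + e)) (sym (+-identityʳ h)))) (fermat pp 5))

-- Every prime p ≠ 5 divides F (p − 1)·F (p + 1); for p = 2 this is 2 ∣ F 1·F 3 = 2.
prime∣F[p-1]F[p+1] : ∀ {p} → Prime p → p ≢ 5 → p ∣ F (p ∸ 1) * F (suc p)
prime∣F[p-1]F[p+1] pp p≢5 with prime-2-or-odd pp
... | inj₁ refl          = ∣-refl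
... | inj₂ (h , p≡2h+1) = odd-prime∣F[p-1]F[p+1] {h = h} pp p≢5 p≡2h+1

rank∣p±1 : ∀ {p} → Prime p → p ≢ 5 → z p ∣ p ∸ 1 ⊎ z p ∣ suc p
rank∣p±1 {p} pp p≢5 = Sum.map (∣F⇒rank∣ p (p ∸ 1)) (∣F⇒rank∣ p (suc p))
  (euclidsLemma (F (p ∸ 1)) (F (suc p)) pp (prime∣F[p-1]F[p+1] pp p≢5))
  where
  instance
    p≢0 : NonZero p
    p≢0 = prime⇒nonZero pp

-- z p ≤ p + 1 for every prime p (z 5 = 5).
-- (Case analyses on goals mentioning z use eliminators rather than `with`:
-- with-abstraction would normalise the unfolded search defining z.)
rank≤1+p : ∀ {p} → Prime p → z p ≤ suc p
rank≤1+p {p} pp = by-cases (p ≟ 5)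
  where
  by-cases : Dec (p ≡ 5) → z p ≤ suc p
  by-cases (yes p≡5) = subst (λ x → z x ≤ suc x) (sym p≡5) (n≤1+n 5)
  by-cases (no  p≢5) = [ (λ z∣p-1 → ≤-trans (∣⇒≤ {{p-1≢0}} z∣p-1) (≤-trans (m∸n≤m p 1) (n≤1+n p)))
                       , ∣⇒≤ ]′ (rank∣p±1 pp p≢5)
    where
    p-1≢0 : NonZero (p ∸ 1)
    p-1≢0 = ≢-nonZero (m>n⇒m∸n≢0 (prime≥2 pp))

-- p ∤ z p for every prime p ≠ 5, since p divides neither p − 1 nor p + 1.
prime∤rank : ∀ {p} → Prime p → p ≢ 5 → ¬ p ∣ z p
prime∤rank {p} pp p≢5 p∣z = [ p∤p-1 ∘ ∣-trans p∣z , p∤p+1 ∘ ∣-trans p∣z ]′ (rank∣p±1 pp p≢5)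
  where
  p∤p-1 : ¬ p ∣ p ∸ 1
  p∤p-1 p∣p-1 = <⇒≱ (∸-monoʳ-< {p} {1} {0} z<s (<⇒≤ (prime≥2 pp)))
                    (∣⇒≤ {{≢-nonZero (m>n⇒m∸n≢0 (prime≥2 pp))}} p∣p-1)
  p∤p+1 : ¬ p ∣ suc p
  p∤p+1 p∣p+1 = <⇒≢ (prime≥2 pp) (sym (∣1⇒≡1 (∣m+n∣m⇒∣n (subst (p ∣_) (+-comm 1 p) p∣p+1) (∣-refl {p}))))

-- ℓ p = p·z p for p ≠ 5, since gcd(p, z p) = 1.
ℓ[p]≡p*z[p] : ∀ {p} → Prime p → p ≢ 5 → ℓ p ≡ p * z p
ℓ[p]≡p*z[p] {p} pp p≢5 = begin
  ℓ p                ≡⟨ *-identityˡ (ℓ p) ⟨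
  1 * ℓ p            ≡⟨ cong (_* ℓ p) (coprime⇒gcd≡1 p⊥z) ⟨
  gcd p (z p) * ℓ p  ≡⟨ gcd*lcm p (z p) ⟩
  p * z p            ∎
  where
  open ≡-Reasoning
  p⊥z : Coprime p (z p)
  p⊥z {i} (i∣p , i∣z) = [ id , (λ i≡p → contradiction (subst (_∣ z p) i≡p i∣z) (prime∤rank pp p≢5)) ]′
    (prime⇒irreducible pp i∣p)

half-≤ : ∀ a b → 2 * a ≤ suc (2 * b) → a ≤ b
half-≤ a b 2a≤1+2b = s≤s⁻¹ (*-cancelˡ-< 2 a (suc b) (subst (2 * a <_) (sym (*-suc 2 b)) (s≤s 2a≤1+2b)))

close-primes : ∀ {p q} → Prime p → Prime q → p ≢ q → p ≤ suc q → q ≤ suc p → p ≡ 2 ⊎ p ≡ 3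
close-primes {p} {q} pp pq p≢q p≤1+q q≤1+p with prime-2-or-odd pp | prime-2-or-odd pq
... | inj₁ p≡2 | _ = inj₁ p≡2
... | inj₂ _   | inj₁ refl = two-or-three (prime≥2 pp) p≤1+q
  where
  two-or-three : ∀ {p} → 2 ≤ p → p ≤ 3 → p ≡ 2 ⊎ p ≡ 3
  two-or-three {1} (s≤s ()) _
  two-or-three {2} _ _ = inj₁ refl
  two-or-three {3} _ _ = inj₂ refl
  two-or-three {suc (suc (suc (suc _)))} _ (s≤s (s≤s (s≤s ())))
... | inj₂ (a , refl) | inj₂ (b , refl) =
  contradiction (cong (λ c → suc (2 * c)) (≤-antisym (half-≤ a b (s≤s⁻¹ p≤1+q)) (half-≤ b a (s≤s⁻¹ q≤1+p)))) p≢q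

NoPrimeℓ∣rank : ℕ → Set
NoPrimeℓ∣rank p = (q : ℕ) → Prime q → ¬ (ℓ q ∣ z p)

prime∣prime⇒≡ : ∀ {p q} → Prime p → Prime q → q ∣ p → q ≡ p
prime∣prime⇒≡ pp pq q∣p = [ (λ q≡1 → contradiction (sym q≡1) (<⇒≢ (prime≥2 pq))) , id ]′
  (prime⇒irreducible pp q∣p)

prime∤⇒coprime : ∀ {p a} → Prime p → ¬ p ∣ a → Coprime a p
prime∤⇒coprime pp p∤a {i} (i∣a , i∣p) =
  [ id , (λ i≡p → contradiction (subst (_∣ _) i≡p i∣a) p∤a) ]′ (prime⇒irreducible pp i∣p)

-- For primes p ≠ q, p ∣ ℓ q forces p ≤ q + 1: p ∣ ℓ q ∣ q·z q gives p ∣ z q ≤ q + 1.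
prime∣ℓ⇒≤ : ∀ {p q} → Prime p → Prime q → p ≢ q → p ∣ ℓ q → p ≤ suc q
prime∣ℓ⇒≤ {p} {q} pp pq p≢q p∣ℓq =
  [ (λ p∣q → contradiction (prime∣prime⇒≡ pq pp p∣q) p≢q)
  , (λ p∣zq → ≤-trans (∣⇒≤ {{>-nonZero (rank-pos q {{prime⇒nonZero pq}})}} p∣zq) (rank≤1+p pq)) ]′
  (euclidsLemma q (z q) pp (∣-trans p∣ℓq (lcm-least {q} {z q} (m∣m*n (z q)) (n∣m*n q))))

-- A prime q ≠ p dividing g (ℓ p) is impossible: then ℓ q ∣ ℓ p = p·z p and
-- q ∣ z p; as p, q are not the close pair {2, 3}, p ∤ ℓ q, so ℓ q ∣ z p.
other-prime∤g[ℓp] : ∀ {p q} → Prime p → p ≢ 2 → p ≢ 3 → p ≢ 5 → NoPrimeℓ∣rank p →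
                    Prime q → q ≢ p → ¬ q ∣ g (ℓ p)
other-prime∤g[ℓp] {p} {q} pp p≢2 p≢3 p≢5 hyp pq q≢p q∣g =
  hyp q pq (coprime-divisor (prime∤⇒coprime pp p∤ℓq) ℓq∣p*z)
  where
  instance
    p≢0 : NonZero p
    p≢0 = prime⇒nonZero pp
    q≢0 : NonZero q
    q≢0 = prime⇒nonZero pq
  ℓq∣p*z : ℓ q ∣ p * z p
  ℓq∣p*z = subst (ℓ q ∣_) (ℓ[p]≡p*z[p] pp p≢5) (Equivalence.to (∣g⇔ℓ∣ (ℓ p) q) q∣g)
  q∣z : q ∣ z p
  q∣z = [ (λ q∣p → contradiction (prime∣prime⇒≡ pp pq q∣p) q≢p) , id ]′
    (euclidsLemma p (z p) pq (subst (q ∣_) (ℓ[p]≡p*z[p] pp p≢5) (∣-trans q∣g (gcd[m,n]∣m (ℓ p) (F (ℓ p))))))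
  q≤1+p : q ≤ suc p
  q≤1+p = ≤-trans (∣⇒≤ {{>-nonZero (rank-pos p)}} q∣z) (rank≤1+p pp)
  p∤ℓq : ¬ p ∣ ℓ q
  p∤ℓq p∣ℓq = [ p≢2 , p≢3 ]′ (close-primes pp pq (q≢p ∘ sym) (prime∣ℓ⇒≤ pp pq (q≢p ∘ sym) p∣ℓq) q≤1+p)

prime-divisor : ∀ {t} → 2 ≤ t → ∃[ q ] Prime q × q ∣ t
prime-divisor {t@(suc _)} 2≤t with factorise t
... | record { factors = [] ; isFactorisation = t≡1 } = contradiction t≡1 (<⇒≢ 2≤t ∘ sym)
... | record { factors = q ∷ qs ; isFactorisation = t≡∏ ; factorsPrime = pq All.∷ _ } =
  q , pq , subst (q ∣_) (sym t≡∏) (m∣m*n (product qs))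

-- p² ∤ g (ℓ p) for a prime p ≠ 5, as p·p ∣ g (ℓ p) ∣ ℓ p = p·z p would give p ∣ z p.
p²∤g[ℓp] : ∀ {p} → Prime p → p ≢ 5 → ¬ p * p ∣ g (ℓ p)
p²∤g[ℓp] {p} pp p≢5 p²∣g = prime∤rank pp p≢5 (*-cancelˡ-∣ p {{prime⇒nonZero pp}}
  (∣-trans p²∣g (subst (g (ℓ p) ∣_) (ℓ[p]≡p*z[p] pp p≢5) (gcd[m,n]∣m (ℓ p) (F (ℓ p))))))

-- Under the hypothesis of (vi), g (ℓ p) = p for primes p ∉ {2, 3, 5}: writing
-- g (ℓ p) = t·p, a prime divisor of t is excluded by p²∤g[ℓp] or other-prime∤g[ℓp].
g[ℓp]≡p : ∀ {p} → Prime p → p ≢ 2 → p ≢ 3 → p ≢ 5 → NoPrimeℓ∣rank p → g (ℓ p) ≡ p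
g[ℓp]≡p {p} pp p≢2 p≢3 p≢5 hyp = from-quotient (Equivalence.from (∣g⇔ℓ∣ (ℓ p) p) ∣-refl)
  where
  instance
    p≢0 : NonZero p
    p≢0 = prime⇒nonZero pp
  g≢0 : g (ℓ p) ≢ 0
  g≢0 = gcd[m,n]≢0 (ℓ p) (F (ℓ p)) (inj₁ (λ ℓ≡0 → <⇒≢ (ℓ-pos p) (sym ℓ≡0)))
  no-prime-factor : ∀ {t} → g (ℓ p) ≡ t * p → ∀ {q} → Prime q → ¬ q ∣ t
  no-prime-factor {t} g≡t*p {q} pq q∣t = by-cases (q ≟ p)
    where
    by-cases : Dec (q ≡ p) → ⊥
    by-cases (yes q≡p) = p²∤g[ℓp] pp p≢5 (subst (p * p ∣_) (sym g≡t*p) (*-monoˡ-∣ p (subst (_∣ t) q≡p q∣t)))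
    by-cases (no  q≢p) = other-prime∤g[ℓp] pp p≢2 p≢3 p≢5 hyp pq q≢p (subst (q ∣_) (sym g≡t*p) (∣-trans q∣t (m∣m*n p)))
  from-quotient : p ∣ g (ℓ p) → g (ℓ p) ≡ p
  from-quotient (divides zero          g≡0)   = contradiction g≡0 g≢0
  from-quotient (divides 1             g≡1*p) = trans g≡1*p (+-identityʳ p)
  from-quotient (divides (suc (suc t)) g≡t*p) =
    let q , pq , q∣t = prime-divisor {suc (suc t)} (s≤s (s≤s z≤n)) in
    contradiction q∣t (no-prime-factor g≡t*p pq)

-- (vi) A prime p ≠ 3 with ℓ q ∤ z p for all primes q lies in 𝒜
-- (2 = g 6 and 5 = g 5 directly, the other primes by g[ℓp]≡p).
prime∈𝒜 : ∀ {p} → Prime p → p ≢ 3 → NoPrimeℓ∣rank p → p ∈𝒜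
prime∈𝒜 {p} pp p≢3 hyp = by-cases (p ≟ 2) (p ≟ 5)
  where
  by-cases : Dec (p ≡ 2) → Dec (p ≡ 5) → p ∈𝒜
  by-cases (yes p≡2) _         = subst _∈𝒜 (sym p≡2) (6 , s≤s z≤n , refl)
  by-cases (no  _)   (yes p≡5) = subst _∈𝒜 (sym p≡5) (5 , s≤s z≤n , refl)
  by-cases (no  p≢2) (no  p≢5) = ℓ p , ℓ-pos p {{prime⇒nonZero pp}} , g[ℓp]≡p pp p≢2 p≢3 p≢5 hyp

lemma2p2 : (m n p : ℕ) → 1 ≤ m → 1 ≤ n → Prime p →
    ((m ∣ n → g m ∣ g n)
    × ((n ∣ g m) ⇔ (ℓ n ∣ m))
    × ((n ∈𝒜) ⇔ (n ≡ g (ℓ n)))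
    × (ℓ p ∣ ℓ n → n ∈𝒜 → p ∣ n)
    × (p ≢ 5 → ℓ p ≡ p * z p)
    × (ℓ 5 ≡ 5)
    × (p ≢ 3 → ((q : ℕ) → Prime q → ¬ (ℓ q ∣ z p)) → p ∈𝒜))
lemma2p2 m n p _ n≥1 pp =
    g-mono-∣ m n
  , ∣g⇔ℓ∣ m n
  , ∈𝒜⇔g[ℓ]≡ n
  , ℓ∣ℓ⇒∣ n p
  , ℓ[p]≡p*z[p] pp
  , refl
  , prime∈𝒜 pp
  where
  instance
    n≢0 : NonZero n
    n≢0 = >-nonZero n≥1
    p≢0 : NonZero p
    p≢0 = prime⇒nonZero pp
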